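{- For all $d\ge 1$, with $\tau = d\,(d-1)\ldots 2\,1$ the decreasing permutation of length $d$, $$B^1_{\tau}(x) = \frac{x^d}{(1-x)^{d-1}}.$$
   Context: $S_n$ is the set of permutations of $\{1,\dots,n\}$ in one-line notation. An occurrence of a pattern $\sigma\in S_k$ in a permutation is a subsequence of length $k$ whose entries are in the same relative order as $\sigma$; a permutation avoids $\sigma$ if it has no occurrence. $\mathcal{P}_n(132)$ is the set of permutations in $S_n$ avoiding each of $132$, $2341$, $3241$ (equivalently, the two-stack sortable permutations avoiding $132$). For a pattern $\tau$, $B^1_\tau(x)=\sum_{n\ge 0}b_n x^n$ where $b_n$ is the number of permutations in $\mathcal{P}_n(132)$ containing exactly one occurrence of $\tau$. -}

module Defs where

open import Data.Nat using (ℕ; zero; suc; _∸_)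
open import Data.Integer as ℤ using (ℤ; +_; -_)
open import Data.Fin using (Fin; opposite) renaming (_<_ to _<ᶠ_)
open import Data.Fin.Patterns using (0F; 1F; 2F; 3F)
open import Data.Vec using (Vec; lookup; tabulate; _∷_; [])
open import Data.List using (List; length)
open import Data.List.Membership.Propositional using (_∈_)
open import Data.List.Relation.Unary.Unique.Propositional using (Unique)
open import Data.Product using (Σ; _×_; ∃)
open import Function.Bundles using (_⇔_)
open import Relation.Nullary using (¬_)
open import Relation.Binary.PropositionalEquality using (_≡_)

-- A permutation of {1,…,n} in one-line notation, with values shifted to
-- {0,…,n-1} (i.e. Fin n): a length-n vector of Fin n with distinct entries.
IsPerm : ∀ {n} → Vec (Fin n) n → Set
IsPerm {n} w = ∀ (i j : Fin n) → lookup w i ≡ lookup w j → i ≡ j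

IsOccurrence : ∀ {k n} → Vec (Fin k) k → Vec (Fin n) n → (Fin k → Fin n) → Set
IsOccurrence {k} σ w f =
  (∀ (a b : Fin k) → a <ᶠ b → f a <ᶠ f b) ×
  (∀ (a b : Fin k) → (lookup w (f a) <ᶠ lookup w (f b)) ⇔ (lookup σ a <ᶠ lookup σ b))

Contains : ∀ {k n} → Vec (Fin k) k → Vec (Fin n) n → Set
Contains σ w = ∃ λ f → IsOccurrence σ w f

Avoids : ∀ {k n} → Vec (Fin k) k → Vec (Fin n) n → Set
Avoids σ w = ¬ Contains σ w

-- exactly one occurrence (occurrences identified as position sets,
-- i.e. pointwise-equal position maps)
ExactlyOne : ∀ {k n} → Vec (Fin k) k → Vec (Fin n) n → Set
ExactlyOne {k} σ w =
  Contains σ w ×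
  (∀ f g → IsOccurrence σ w f → IsOccurrence σ w g → ∀ (i : Fin k) → f i ≡ g i)

-- patterns 132, 2341, 3241 (values shifted down by one)
p132 : Vec (Fin 3) 3
p132 = 0F ∷ 2F ∷ 1F ∷ []

p2341 : Vec (Fin 4) 4
p2341 = 1F ∷ 2F ∷ 3F ∷ 0F ∷ []

p3241 : Vec (Fin 4) 4
p3241 = 2F ∷ 1F ∷ 3F ∷ 0F ∷ []

InP132 : ∀ {n} → Vec (Fin n) n → Set
InP132 w = IsPerm w × Avoids p132 w × Avoids p2341 w × Avoids p3241 w

decreasing : (d : ℕ) → Vec (Fin d) d
decreasing d = tabulate opposite

IsCardinality : ∀ {n} → (Vec (Fin n) n → Set) → ℕ → Set
IsCardinality {n} P c =
  Σ (List (Vec (Fin n) n)) λ L → Unique L × (∀ w → (w ∈ L) ⇔ P w) × length L ≡ c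

CountsB1 : ∀ {k} → Vec (Fin k) k → (ℕ → ℕ) → Set
CountsB1 τ b = ∀ n → IsCardinality {n} (λ w → InP132 w × ExactlyOne τ w) (b n)

Series : Set
Series = ℕ → ℤ

sumTo : ℕ → (ℕ → ℤ) → ℤ
sumTo zero f = f zero
sumTo (suc n) f = sumTo n f ℤ.+ f (suc n)

_⊛_ : Series → Series → Series
(f ⊛ g) n = sumTo n (λ i → f i ℤ.* g (n ∸ i))

oneS : Series
oneS zero = + 1
oneS (suc _) = + 0

powS : Series → ℕ → Series
powS f zero = oneS
powS f (suc m) = f ⊛ powS f m

oneMinusX : Series
oneMinusX zero = + 1
oneMinusX (suc zero) = - (+ 1)
oneMinusX (suc (suc _)) = + 0

xPow : ℕ → Series
xPow zero zero = + 1
xPow zero (suc _) = + 0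
xPow (suc d) zero = + 0
xPow (suc d) (suc n) = xPow d n

gf : (ℕ → ℕ) → Series
gf b n = + (b n)

{-# OPTIONS --safe #-}
module Submission where

-- Write d = e + 2. A permutation w ∈ 𝒫_n(132) contains d…21 exactly once iff it is a
-- valley: w₀ > w₁ > … > w_{e+1} < w_{e+2} < … < w_{n-1} with w_e below every entry after
-- position e + 1, the occurrence being w₀…w_{e+1}. Indeed, an entry outside the unique
-- occurrence either could replace one of its entries, giving a second occurrence, or
-- completes a 132 or a 3241 with it. In a valley the largest entry is first or last, and
-- removing it gives Pascal's rule, so there are C(n-2, e) valleys of length n. Multiplying
-- a series by 1 - x takes differences, and e + 1 differences turn Σ C(n-2, e) xⁿ into
-- x^(e+2). For d = 1 only the permutation of length 1 is counted.

open import Defs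
open import Data.Nat using (ℕ; zero; suc; _+_; _∸_; _≤_; _<_; z≤n; s≤s; z<s; s<s)
open import Data.Nat.Properties
open import Data.Nat.Combinatorics using (_C_; nCk+nC[k+1]≡[n+1]C[k+1])
open import Data.Integer as ℤ using (ℤ; +_)
import Data.Integer.Properties as ℤ
open import Data.Integer.Tactic.RingSolver using (solve-∀)
open import Data.Fin as F using (Fin; toℕ; fromℕ; fromℕ<; inject₁) renaming (_<_ to _<ᶠ_)
open import Data.Fin.Patterns using (0F; 1F; 2F; 3F)
import Data.Fin.Properties as Finₚ
open Finₚ using (toℕ<n; toℕ-injective; toℕ-fromℕ; toℕ-fromℕ<; toℕ-inject₁)
open import Data.Vec using (Vec; []; _∷_; _∷ʳ_; lookup; tabulate; map; initLast)
open import Data.Vec.Properties using (lookup∘tabulate; ∷-injectiveˡ; ∷-injectiveʳ; ∷ʳ-injectiveˡ)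
open import Data.List as L using (List; []; _∷_; _++_; length)
open import Data.List.Properties using (length-map; length-++)
open import Data.List.Membership.Propositional using (_∈_)
open import Data.List.Membership.Propositional.Properties using (∈-map⁺; ∈-map⁻; ∈-++⁺ˡ; ∈-++⁺ʳ; ∈-++⁻)
open import Data.List.Membership.Propositional.Properties.WithK using (unique∧set⇒bag)
open import Data.List.Relation.Unary.Any using (here)
import Data.List.Relation.Unary.All as All
open import Data.List.Relation.Unary.AllPairs using ([]; _∷_)
open import Data.List.Relation.Unary.Unique.Propositional using (Unique)
import Data.List.Relation.Unary.Unique.Propositional.Properties as Unique
open import Data.List.Relation.Binary.Disjoint.Propositional using (Disjoint)
open import Data.List.Relation.Binary.BagAndSetEquality using (∼bag⇒↭)
open import Data.List.Relation.Binary.Permutation.Propositional.Properties using (↭-length)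
open import Data.Product using (Σ; _×_; _,_; proj₁; proj₂)
open import Data.Sum using (_⊎_; inj₁; inj₂; [_,_]′)
open import Data.Empty using (⊥; ⊥-elim)
open import Data.Unit using (tt)
open import Function.Bundles using (mk⇔; Equivalence)
open import Relation.Nullary using (Dec; yes; no)
open import Relation.Nullary.Decidable using (_→-dec_; toWitness)
open import Relation.Binary.Definitions using (tri<; tri≈; tri>)
open import Relation.Binary.PropositionalEquality
  using (_≡_; _≢_; _≗_; refl; sym; trans; cong; cong₂; subst; subst₂; module ≡-Reasoning)

-- Formal power series

Δ : Series → Series
Δ f zero    = f zero
Δ f (suc n) = f (suc n) ℤ.- f n

Δ^ : ℕ → Series → Series
Δ^ zero    f = f
Δ^ (suc k) f = Δ^ k (Δ f)

shift : Series → Series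
shift f zero    = + 0
shift f (suc n) = f n

binomS : ℕ → Series
binomS e n = + (n C e)

Δ-cong : ∀ {f g} → f ≗ g → Δ f ≗ Δ g
Δ-cong f≗g zero    = f≗g zero
Δ-cong f≗g (suc n) = cong₂ ℤ._-_ (f≗g (suc n)) (f≗g n)

Δ^-cong : ∀ k {f g} → f ≗ g → Δ^ k f ≗ Δ^ k g
Δ^-cong zero    f≗g = f≗g
Δ^-cong (suc k) f≗g = Δ^-cong k (Δ-cong f≗g)

Δ^-suc : ∀ k f → Δ^ (suc k) f ≗ Δ (Δ^ k f)
Δ^-suc zero    f n = refl
Δ^-suc (suc k) f n = Δ^-suc k (Δ f) n

shift-cong : ∀ {f g} → f ≗ g → shift f ≗ shift g
shift-cong f≗g zero    = refl
shift-cong f≗g (suc n) = f≗g n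

Δ-shift : ∀ f → Δ (shift f) ≗ shift (Δ f)
Δ-shift f zero          = refl
Δ-shift f (suc zero)    = ℤ.+-identityʳ (f zero)
Δ-shift f (suc (suc n)) = refl

Δ^-shift : ∀ k f → Δ^ k (shift f) ≗ shift (Δ^ k f)
Δ^-shift zero    f n = refl
Δ^-shift (suc k) f n = trans (Δ^-cong k (Δ-shift f) n) (Δ^-shift k (Δ f) n)

shift-xPow : ∀ d → shift (xPow d) ≗ xPow (suc d)
shift-xPow d zero    = refl
shift-xPow d (suc n) = refl

Δ-binomS-zero : Δ (binomS 0) ≗ xPow 0
Δ-binomS-zero zero    = refl
Δ-binomS-zero (suc n) = refl

Δ-binomS-suc : ∀ e → Δ (binomS (suc e)) ≗ shift (binomS e)
Δ-binomS-suc e zero    = refl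
Δ-binomS-suc e (suc n) = begin
  + (suc n C suc e) ℤ.- + (n C suc e)
    ≡⟨ cong (λ m → + m ℤ.- + (n C suc e)) (nCk+nC[k+1]≡[n+1]C[k+1] n e) ⟨
  + (n C e + n C suc e) ℤ.- + (n C suc e)
    ≡⟨ ℤ.[+m]-[+n]≡m⊖n (n C e + n C suc e) (n C suc e) ⟩
  (n C e + n C suc e) ℤ.⊖ (n C suc e)
    ≡⟨ ℤ.⊖-≥ (m≤n+m (n C suc e) (n C e)) ⟩
  + (n C e + n C suc e ∸ n C suc e)
    ≡⟨ cong +_ (m+n∸n≡m (n C e) (n C suc e)) ⟩
  + (n C e)
    ∎
  where open ≡-Reasoning

Δ^-binomS : ∀ k → Δ^ (suc k) (binomS k) ≗ xPow k
Δ^-binomS zero      = Δ-binomS-zero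
Δ^-binomS (suc k) n = begin
  Δ^ (suc k) (Δ (binomS (suc k))) n  ≡⟨ Δ^-cong (suc k) (Δ-binomS-suc k) n ⟩
  Δ^ (suc k) (shift (binomS k)) n    ≡⟨ Δ^-shift (suc k) (binomS k) n ⟩
  shift (Δ^ (suc k) (binomS k)) n    ≡⟨ shift-cong (Δ^-binomS k) n ⟩
  shift (xPow k) n                   ≡⟨ shift-xPow k n ⟩
  xPow (suc k) n                     ∎
  where open ≡-Reasoning

Δ^-shift²-binomS : ∀ e → Δ^ (suc e) (shift (shift (binomS e))) ≗ xPow (2 + e)
Δ^-shift²-binomS e n = begin
  Δ^ (suc e) (shift (shift (binomS e))) n  ≡⟨ Δ^-shift (suc e) (shift (binomS e)) n ⟩
  shift (Δ^ (suc e) (shift (binomS e))) n  ≡⟨ shift-cong (Δ^-shift (suc e) (binomS e)) n ⟩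
  shift (shift (Δ^ (suc e) (binomS e))) n  ≡⟨ shift-cong (shift-cong (Δ^-binomS e)) n ⟩
  shift (shift (xPow e)) n                 ≡⟨ shift-cong (shift-xPow e) n ⟩
  shift (xPow (suc e)) n                   ≡⟨ shift-xPow (suc e) n ⟩
  xPow (2 + e) n                           ∎
  where open ≡-Reasoning

sumTo-cong : ∀ n {f g : ℕ → ℤ} → (∀ i → i ≤ n → f i ≡ g i) → sumTo n f ≡ sumTo n g
sumTo-cong zero    f≗g = f≗g zero z≤n
sumTo-cong (suc n) f≗g =
  cong₂ ℤ._+_ (sumTo-cong n (λ i i≤n → f≗g i (m≤n⇒m≤1+n i≤n))) (f≗g (suc n) ≤-refl)

sumTo-zero : ∀ n → sumTo n (λ _ → + 0) ≡ + 0
sumTo-zero zero    = refl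
sumTo-zero (suc n) = cong (ℤ._+ + 0) (sumTo-zero n)

sumTo-- : ∀ n (f g : ℕ → ℤ) → sumTo n (λ i → f i ℤ.- g i) ≡ sumTo n f ℤ.- sumTo n g
sumTo-- zero    f g = refl
sumTo-- (suc n) f g =
  trans (cong (ℤ._+ (f (suc n) ℤ.- g (suc n))) (sumTo-- n f g))
        (interchange (sumTo n f) (sumTo n g) (f (suc n)) (g (suc n)))
  where
  interchange : ∀ a b c d → (a ℤ.- b) ℤ.+ (c ℤ.- d) ≡ (a ℤ.+ c) ℤ.- (b ℤ.+ d)
  interchange = solve-∀

sumTo-oneMinusX : ∀ k (h : ℕ → ℤ) → sumTo (suc k) (λ i → oneMinusX i ℤ.* h i) ≡ h 0 ℤ.- h 1
sumTo-oneMinusX zero    h = cong₂ ℤ._+_ (ℤ.*-identityˡ (h 0)) (ℤ.-1*i≡-i (h 1))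
sumTo-oneMinusX (suc k) h =
  trans (cong₂ ℤ._+_ (sumTo-oneMinusX k h) (ℤ.*-zeroˡ (h (suc (suc k))))) (ℤ.+-identityʳ _)

⊛-congʳ : ∀ f {g h} → g ≗ h → (f ⊛ g) ≗ (f ⊛ h)
⊛-congʳ f g≗h n = sumTo-cong n (λ i _ → cong (f i ℤ.*_) (g≗h (n ∸ i)))

⊛-suc : ∀ f g n → (f ⊛ g) (suc n) ≡ sumTo n (λ i → f i ℤ.* g (suc (n ∸ i))) ℤ.+ f (suc n) ℤ.* g 0
⊛-suc f g n =
  cong₂ ℤ._+_ (sumTo-cong n (λ i i≤n → cong (λ m → f i ℤ.* g m) (+-∸-assoc 1 i≤n)))
              (cong (λ m → f (suc n) ℤ.* g m) (n∸n≡0 n))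

⊛-identityʳ : ∀ f → (f ⊛ oneS) ≗ f
⊛-identityʳ f zero    = ℤ.*-identityʳ (f 0)
⊛-identityʳ f (suc n) = begin
  (f ⊛ oneS) (suc n)
    ≡⟨ ⊛-suc f oneS n ⟩
  sumTo n (λ i → f i ℤ.* + 0) ℤ.+ f (suc n) ℤ.* + 1
    ≡⟨ cong₂ ℤ._+_ (sumTo-cong n (λ i _ → ℤ.*-zeroʳ (f i))) (ℤ.*-identityʳ (f (suc n))) ⟩
  sumTo n (λ _ → + 0) ℤ.+ f (suc n)
    ≡⟨ cong (ℤ._+ f (suc n)) (sumTo-zero n) ⟩
  + 0 ℤ.+ f (suc n)
    ≡⟨ ℤ.+-identityˡ (f (suc n)) ⟩
  f (suc n)
    ∎
  where open ≡-Reasoning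

oneMinusX-⊛ : ∀ g → (oneMinusX ⊛ g) ≗ Δ g
oneMinusX-⊛ g zero    = ℤ.*-identityˡ (g 0)
oneMinusX-⊛ g (suc n) = sumTo-oneMinusX n (λ i → g (suc n ∸ i))

⊛-Δ : ∀ f g → (f ⊛ Δ g) ≗ Δ (f ⊛ g)
⊛-Δ f g zero    = refl
⊛-Δ f g (suc n) = begin
  (f ⊛ Δ g) (suc n)
    ≡⟨ ⊛-suc f (Δ g) n ⟩
  sumTo n (λ i → f i ℤ.* (g⁺ i ℤ.- g (n ∸ i))) ℤ.+ c
    ≡⟨ cong (ℤ._+ c) (sumTo-cong n (λ i _ → *-distrib-- (f i) (g⁺ i) (g (n ∸ i)))) ⟩
  sumTo n (λ i → f i ℤ.* g⁺ i ℤ.- f i ℤ.* g (n ∸ i)) ℤ.+ c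
    ≡⟨ cong (ℤ._+ c) (sumTo-- n _ _) ⟩
  (S ℤ.- (f ⊛ g) n) ℤ.+ c
    ≡⟨ swap S ((f ⊛ g) n) c ⟩
  (S ℤ.+ c) ℤ.- (f ⊛ g) n
    ≡⟨ cong (ℤ._- (f ⊛ g) n) (⊛-suc f g n) ⟨
  (f ⊛ g) (suc n) ℤ.- (f ⊛ g) n
    ∎
  where
  open ≡-Reasoning
  g⁺ : ℕ → ℤ
  g⁺ i = g (suc (n ∸ i))
  S c : ℤ
  S = sumTo n (λ i → f i ℤ.* g⁺ i)
  c = f (suc n) ℤ.* g 0
  *-distrib-- : ∀ a b c → a ℤ.* (b ℤ.- c) ≡ a ℤ.* b ℤ.- a ℤ.* c
  *-distrib-- = solve-∀
  swap : ∀ a b c → (a ℤ.- b) ℤ.+ c ≡ (a ℤ.+ c) ℤ.- b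
  swap = solve-∀

⊛-powS-oneMinusX : ∀ m f → (f ⊛ powS oneMinusX m) ≗ Δ^ m f
⊛-powS-oneMinusX zero    f n = ⊛-identityʳ f n
⊛-powS-oneMinusX (suc m) f n = begin
  (f ⊛ (oneMinusX ⊛ powS oneMinusX m)) n  ≡⟨ ⊛-congʳ f (oneMinusX-⊛ (powS oneMinusX m)) n ⟩
  (f ⊛ Δ (powS oneMinusX m)) n            ≡⟨ ⊛-Δ f (powS oneMinusX m) n ⟩
  Δ (f ⊛ powS oneMinusX m) n              ≡⟨ Δ-cong (⊛-powS-oneMinusX m f) n ⟩
  Δ (Δ^ m f) n                            ≡⟨ Δ^-suc m f n ⟨
  Δ^ (suc m) f n                          ∎
  where open ≡-Reasoning

-- Decreasing occurrences and valleys

InjectiveBelow : ℕ → (ℕ → ℕ) → Set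
InjectiveBelow n V = ∀ {p q} → p < n → q < n → V p ≡ V q → p ≡ q

No132 : ℕ → (ℕ → ℕ) → Set
No132 n V = ∀ {a b c} → a < b → b < c → c < n → V a < V c → V c < V b → ⊥

No2341 : ℕ → (ℕ → ℕ) → Set
No2341 n V = ∀ {a b c z} → a < b → b < c → c < z → z < n →
             V z < V a → V a < V b → V b < V c → ⊥

No3241 : ℕ → (ℕ → ℕ) → Set
No3241 n V = ∀ {a b c z} → a < b → b < c → c < z → z < n →
             V b < V a → V a < V c → V z < V b → ⊥

record DecreasingOcc (d n : ℕ) (V P : ℕ → ℕ) : Set where
  field
    positions-increase : ∀ {j k} → j < k → k < d → P j < P k
    values-decrease    : ∀ {j k} → j < k → k < d → V (P k) < V (P j)
    in-range           : ∀ {j} → j < d → P j < n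

UniqueDecreasingOcc : ℕ → ℕ → (ℕ → ℕ) → (ℕ → ℕ) → Set
UniqueDecreasingOcc d n V P = ∀ Q → DecreasingOcc d n V Q → ∀ {j} → j < d → Q j ≡ P j

record IsValley (e n : ℕ) (V : ℕ → ℕ) : Set where
  field
    long-enough : 2 + e ≤ n
    descent     : ∀ {i j} → i < j → j ≤ suc e → V j < V i
    ascent      : ∀ {i j} → suc e ≤ i → i < j → j < n → V i < V j
    tail-above  : ∀ {j} → 2 + e ≤ j → j < n → V e < V j

increasing-by-steps : ∀ {k} {f : ℕ → ℕ} → (∀ {i} → suc i < k → f i < f (suc i)) →
                      ∀ {i j} → i < j → j < k → f i < f j
increasing-by-steps step {j = suc j} i<1+j 1+j<k with m<1+n⇒m<n∨m≡n i<1+j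
... | inj₁ i<j  = <-trans (increasing-by-steps step i<j (<-trans (n<1+n j) 1+j<k)) (step 1+j<k)
... | inj₂ refl = step 1+j<k

distinct-values : ∀ {n V} → InjectiveBelow n V → ∀ {p q} → p < n → q < n → p ≢ q →
                  V p < V q ⊎ V q < V p
distinct-values {V = V} inj {p} {q} p<n q<n p≢q with <-cmp (V p) (V q)
... | tri< Vp<Vq _ _ = inj₁ Vp<Vq
... | tri≈ _ Vp≡Vq _ = ⊥-elim (p≢q (inj p<n q<n Vp≡Vq))
... | tri> _ _ Vq<Vp = inj₂ Vq<Vp

replace : (ℕ → ℕ) → ℕ → ℕ → ℕ → ℕ
replace P k q j with j ≟ k
... | yes _ = q
... | no  _ = P j

replace-≡ : ∀ P k q → replace P k q k ≡ q
replace-≡ P k q with k ≟ k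
... | yes _   = refl
... | no  k≢k = ⊥-elim (k≢k refl)

FitsLeft : (V P : ℕ → ℕ) → ℕ → ℕ → Set
FitsLeft V P k q = ∀ {j} → j < k → P j < q × V q < V (P j)

FitsRight : ℕ → (V P : ℕ → ℕ) → ℕ → ℕ → Set
FitsRight d V P k q = ∀ {j} → k < j → j < d → q < P j × V (P j) < V q

module _ {d n V P} (occ : DecreasingOcc d n V P) where
  open DecreasingOcc occ

  positions-≤ : ∀ {j k} → j ≤ k → k < d → P j ≤ P k
  positions-≤ j≤k k<d with m≤n⇒m<n∨m≡n j≤k
  ... | inj₁ j<k  = <⇒≤ (positions-increase j<k k<d)
  ... | inj₂ refl = ≤-refl

  values-≥ : ∀ {j k} → j ≤ k → k < d → V (P k) ≤ V (P j)
  values-≥ j≤k k<d with m≤n⇒m<n∨m≡n j≤k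
  ... | inj₁ j<k  = <⇒≤ (values-decrease j<k k<d)
  ... | inj₂ refl = ≤-refl

  fitsLeft-first : ∀ {q} → FitsLeft V P 0 q
  fitsLeft-first ()

  fitsRight-last : ∀ {k q} → d ≤ suc k → FitsRight d V P k q
  fitsRight-last d≤1+k k<j j<d = ⊥-elim (<⇒≱ j<d (≤-trans d≤1+k k<j))

  fitsLeft-neighbour : ∀ {k q} → suc k < d → P k < q → V q < V (P k) → FitsLeft V P (suc k) q
  fitsLeft-neighbour {k} 1+k<d Pk<q Vq<VPk {j} j<1+k =
    ≤-<-trans (positions-≤ j≤k k<d) Pk<q , <-≤-trans Vq<VPk (values-≥ j≤k k<d)
    where
    k<d : k < d
    k<d = <-trans (n<1+n k) 1+k<d
    j≤k : j ≤ k
    j≤k = ≤-pred j<1+k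

  fitsRight-neighbour : ∀ {k q} → suc k < d → q < P (suc k) → V (P (suc k)) < V q → FitsRight d V P k q
  fitsRight-neighbour _ q<P1+k VP1+k<Vq k<j j<d =
    <-≤-trans q<P1+k (positions-≤ k<j j<d) , ≤-<-trans (values-≥ k<j j<d) VP1+k<Vq

  replace-occurrence : ∀ {k q} → q < n → k < d → FitsLeft V P k q → FitsRight d V P k q →
                       DecreasingOcc d n V (replace P k q)
  replace-occurrence {k} {q} q<n k<d left right = record
    { positions-increase = increase
    ; values-decrease    = decrease
    ; in-range           = range
    }
    where
    increase : ∀ {j l} → j < l → l < d → replace P k q j < replace P k q l
    increase {j} {l} j<l l<d with j ≟ k | l ≟ k
    ... | yes refl | yes refl = ⊥-elim (<-irrefl refl j<l)
    ... | yes refl | no _     = proj₁ (right j<l l<d)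
    ... | no _     | yes refl = proj₁ (left j<l)
    ... | no _     | no _     = positions-increase j<l l<d
    decrease : ∀ {j l} → j < l → l < d → V (replace P k q l) < V (replace P k q j)
    decrease {j} {l} j<l l<d with j ≟ k | l ≟ k
    ... | yes refl | yes refl = ⊥-elim (<-irrefl refl j<l)
    ... | yes refl | no _     = proj₂ (right j<l l<d)
    ... | no _     | yes refl = proj₂ (left j<l)
    ... | no _     | no _     = values-decrease j<l l<d
    range : ∀ {j} → j < d → replace P k q j < n
    range {j} j<d with j ≟ k
    ... | yes _ = q<n
    ... | no _  = in-range j<d

module UniqueOccurrenceIsValley
  {e n V P} (inj : InjectiveBelow n V) (no132 : No132 n V) (no3241 : No3241 n V)
  (occ : DecreasingOcc (2 + e) n V P) (unique : UniqueDecreasingOcc (2 + e) n V P) where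

  open DecreasingOcc occ

  slot-unique : ∀ {k q} → q < n → k < 2 + e → FitsLeft V P k q → FitsRight (2 + e) V P k q → q ≡ P k
  slot-unique {k} {q} q<n k<d left right =
    trans (sym (replace-≡ P k q)) (unique (replace P k q) (replace-occurrence occ q<n k<d left right) k<d)

  nothing-before : ∀ {q} → q < P 0 → ⊥
  nothing-before {q} q<P0 =
    [ (λ Vq<VP1 → no132 q<P0 P0<P1 (in-range 1<d) Vq<VP1 (values-decrease z<s 1<d))
    , (λ VP1<Vq → <⇒≢ q<P0 (slot-unique q<n z<s (fitsLeft-first occ) (fitsRight-neighbour occ 1<d q<P1 VP1<Vq)))
    ]′ (distinct-values inj q<n (in-range 1<d) (<⇒≢ q<P1))
    where
    1<d : 1 < 2 + e
    1<d = s<s z<s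
    P0<P1 : P 0 < P 1
    P0<P1 = positions-increase z<s 1<d
    q<n : q < n
    q<n = <-trans q<P0 (in-range z<s)
    q<P1 : q < P 1
    q<P1 = <-trans q<P0 P0<P1

  gap-above : ∀ {i q} → suc i < 2 + e → P i < q → q < P (suc i) → V (P (suc i)) < V q → ⊥
  gap-above {zero} 1<d P0<q q<P1 VP1<Vq =
    >⇒≢ P0<q (slot-unique (<-trans q<P1 (in-range 1<d)) z<s (fitsLeft-first occ)
                          (fitsRight-neighbour occ 1<d q<P1 VP1<Vq))
  gap-above {suc h} {q} 2+h<d P1+h<q q<P2+h VP2+h<Vq =
    [ (λ Vq<VPh → >⇒≢ P1+h<q (slot-unique q<n 1+h<d (fitsLeft-neighbour occ 1+h<d Ph<q Vq<VPh)
                                             (fitsRight-neighbour occ 2+h<d q<P2+h VP2+h<Vq)))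
    , (λ VPh<Vq → no3241 Ph<P1+h P1+h<q q<P2+h (in-range 2+h<d)
                         (values-decrease (n<1+n h) 1+h<d) VPh<Vq (values-decrease (n<1+n _) 2+h<d))
    ]′ (distinct-values inj q<n (in-range h<d) (>⇒≢ Ph<q))
    where
    1+h<d : suc h < 2 + e
    1+h<d = <-trans (n<1+n _) 2+h<d
    h<d : h < 2 + e
    h<d = <-trans (n<1+n h) 1+h<d
    q<n : q < n
    q<n = <-trans q<P2+h (in-range 2+h<d)
    Ph<P1+h : P h < P (suc h)
    Ph<P1+h = positions-increase (n<1+n h) 1+h<d
    Ph<q : P h < q
    Ph<q = <-trans Ph<P1+h P1+h<q

  gap-below : ∀ {i q} → suc i < 2 + e → P i < q → q < P (suc i) → V q < V (P (suc i)) → ⊥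
  gap-below {i} {q} 1+i<d Pi<q q<P1+i Vq<VP1+i = [ inner , last ]′ (m≤n⇒m<n∨m≡n 1+i<d)
    where
    q<n : q < n
    q<n = <-trans q<P1+i (in-range 1+i<d)
    replaces-slot : FitsRight (2 + e) V P (suc i) q → ⊥
    replaces-slot right = <⇒≢ q<P1+i (slot-unique q<n 1+i<d
      (fitsLeft-neighbour occ 1+i<d Pi<q (<-trans Vq<VP1+i (values-decrease (n<1+n i) 1+i<d))) right)
    last : 2 + i ≡ 2 + e → ⊥
    last 2+i≡d = replaces-slot (fitsRight-last occ (≤-reflexive (sym 2+i≡d)))
    inner : 2 + i < 2 + e → ⊥
    inner 2+i<d =
      [ (λ Vq<VP2+i → no132 q<P1+i P1+i<P2+i (in-range 2+i<d) Vq<VP2+i (values-decrease (n<1+n _) 2+i<d))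
      , (λ VP2+i<Vq → replaces-slot (fitsRight-neighbour occ 2+i<d q<P2+i VP2+i<Vq))
      ]′ (distinct-values inj q<n (in-range 2+i<d) (<⇒≢ q<P2+i))
      where
      P1+i<P2+i : P (suc i) < P (2 + i)
      P1+i<P2+i = positions-increase (n<1+n _) 2+i<d
      q<P2+i : q < P (2 + i)
      q<P2+i = <-trans q<P1+i P1+i<P2+i

  no-gap : ∀ {i q} → suc i < 2 + e → P i < q → q < P (suc i) → ⊥
  no-gap 1+i<d Pi<q q<P1+i =
    [ gap-below 1+i<d Pi<q q<P1+i , gap-above 1+i<d Pi<q q<P1+i ]′
    (distinct-values inj (<-trans q<P1+i (in-range 1+i<d)) (in-range 1+i<d) (<⇒≢ q<P1+i))

  occupies-prefix : ∀ {j} → j < 2 + e → P j ≡ j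
  occupies-prefix {zero}  _     = n≤0⇒n≡0 (≮⇒≥ nothing-before)
  occupies-prefix {suc i} 1+i<d =
    ≤-antisym (≮⇒≥ (no-gap 1+i<d (subst (_< suc i) (sym Pi≡i) (n<1+n i))))
              (subst (_< P (suc i)) Pi≡i (positions-increase (n<1+n i) 1+i<d))
    where
    Pi≡i : P i ≡ i
    Pi≡i = occupies-prefix (<-trans (n<1+n i) 1+i<d)

  after-occurrence : ∀ {q} → P (suc e) < q → q < n → V (P e) < V q
  after-occurrence {q} P1+e<q q<n =
    [ (λ VPe<Vq → VPe<Vq)
    , (λ Vq<VPe → ⊥-elim (>⇒≢ P1+e<q (slot-unique q<n (n<1+n _)
                    (fitsLeft-neighbour occ (n<1+n _) Pe<q Vq<VPe) (fitsRight-last occ ≤-refl))))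
    ]′ (distinct-values inj (in-range e<d) q<n (<⇒≢ Pe<q))
    where
    e<d : e < 2 + e
    e<d = <-trans (n<1+n e) (n<1+n _)
    Pe<q : P e < q
    Pe<q = <-trans (positions-increase (n<1+n e) (n<1+n _)) P1+e<q

  isValley : IsValley e n V
  isValley = record
    { long-enough = subst (_< n) P1+e≡1+e (in-range 1+e<d)
    ; descent     = descent
    ; ascent      = ascent
    ; tail-above  = tail-above
    }
    where
    1+e<d : suc e < 2 + e
    1+e<d = n<1+n (suc e)
    P1+e≡1+e : P (suc e) ≡ suc e
    P1+e≡1+e = occupies-prefix 1+e<d
    descent : ∀ {i j} → i < j → j ≤ suc e → V j < V i
    descent i<j j≤1+e =
      subst₂ (λ a b → V a < V b) (occupies-prefix (s≤s j≤1+e)) (occupies-prefix (<-trans i<j (s≤s j≤1+e)))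
             (values-decrease i<j (s≤s j≤1+e))
    tail-above : ∀ {j} → 2 + e ≤ j → j < n → V e < V j
    tail-above 2+e≤j j<n = subst (λ a → V a < V _) (occupies-prefix (<-trans (n<1+n e) 1+e<d))
                                 (after-occurrence (subst (_< _) (sym P1+e≡1+e) 2+e≤j) j<n)
    ascent : ∀ {i j} → suc e ≤ i → i < j → j < n → V i < V j
    ascent 1+e≤i i<j j<n with m≤n⇒m<n∨m≡n 1+e≤i
    ... | inj₂ refl  = <-trans (descent (n<1+n e) ≤-refl) (tail-above i<j j<n)
    ... | inj₁ 1+e<i =
      [ (λ Vi<Vj → Vi<Vj)
      , (λ Vj<Vi → ⊥-elim (no132 (<-trans (n<1+n e) 1+e<i) i<j j<n (tail-above (<-trans 1+e<i i<j) j<n) Vj<Vi))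
      ]′ (distinct-values inj (<-trans i<j j<n) j<n (<⇒≢ i<j))

module _ {e n V} (valley : IsValley e n V) where
  open IsValley valley

  valley-no132 : No132 n V
  valley-no132 {b = b} a<b b<c c<n Va<Vc Vc<Vb with ≤-total b (suc e)
  ... | inj₁ b≤1+e = <-asym (<-trans Va<Vc Vc<Vb) (descent a<b b≤1+e)
  ... | inj₂ 1+e≤b = <-asym Vc<Vb (ascent 1+e≤b b<c c<n)

  valley-no2341 : No2341 n V
  valley-no2341 {c = c} a<b b<c c<z z<n Vz<Va Va<Vb Vb<Vc with ≤-total c (suc e)
  ... | inj₁ c≤1+e = <-asym (<-trans Va<Vb Vb<Vc) (descent (<-trans a<b b<c) c≤1+e)
  ... | inj₂ 1+e≤c = <-asym (<-trans Vz<Va (<-trans Va<Vb Vb<Vc)) (ascent 1+e≤c c<z z<n)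

  valley-no3241 : No3241 n V
  valley-no3241 {c = c} a<b b<c c<z z<n Vb<Va Va<Vc Vz<Vb with ≤-total c (suc e)
  ... | inj₁ c≤1+e = <-asym Va<Vc (descent (<-trans a<b b<c) c≤1+e)
  ... | inj₂ 1+e≤c = <-asym (<-trans Vz<Vb (<-trans Vb<Va Va<Vc)) (ascent 1+e≤c c<z z<n)

  valley-occurrence : DecreasingOcc (2 + e) n V (λ j → j)
  valley-occurrence = record
    { positions-increase = λ j<k _ → j<k
    ; values-decrease    = λ j<k k<d → descent j<k (≤-pred k<d)
    ; in-range           = λ j<d → <-≤-trans j<d long-enough
    }

  valley-unique : UniqueDecreasingOcc (2 + e) n V (λ j → j)
  valley-unique Q occQ {j} j<d = ≤-antisym (below (suc e ∸ j) (m∸n+n≡m (≤-pred j<d))) (above j<d)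
    where
    open DecreasingOcc occQ
    1+e<d : suc e < 2 + e
    1+e<d = n<1+n (suc e)
    above : ∀ {j} → j < 2 + e → j ≤ Q j
    above {zero}  _     = z≤n
    above {suc j} 1+j<d =
      ≤-trans (s≤s (above (<-trans (n<1+n j) 1+j<d))) (positions-increase (n<1+n j) 1+j<d)
    -- Otherwise Q e and Q (e + 1) both lie in the ascent, or Q e = e lies below the tail.
    last-below : Q (suc e) ≤ suc e
    last-below = ≮⇒≥ λ 1+e<Q1+e →
      [ (λ e<Qe → <-asym (values-decrease (n<1+n e) 1+e<d)
                         (ascent e<Qe (positions-increase (n<1+n e) 1+e<d) (in-range 1+e<d)))
      , (λ e≡Qe → <-asym (values-decrease (n<1+n e) 1+e<d)
                         (subst (λ a → V a < V (Q (suc e))) e≡Qe (tail-above 1+e<Q1+e (in-range 1+e<d))))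
      ]′ (m≤n⇒m<n∨m≡n (above (<-trans (n<1+n e) 1+e<d)))
    below : ∀ k {j} → k + j ≡ suc e → Q j ≤ j
    below zero    refl = last-below
    below (suc k) {j} k+1+j≡1+e =
      ≤-pred (<-≤-trans (positions-increase (n<1+n j) 1+j<d) (below k (trans (+-suc k j) k+1+j≡1+e)))
      where
      1+j<d : suc j < 2 + e
      1+j<d = s≤s (s≤s (subst (j ≤_) (suc-injective k+1+j≡1+e) (m≤n+m j k)))

-- From vectors over Fin to functions on positions

-- The entry of w at position p, read as a natural number; positions beyond the end read 0.
at : ∀ {n m} → Vec (Fin n) m → ℕ → ℕ
at []       _       = 0
at (x ∷ xs) zero    = toℕ x
at (x ∷ xs) (suc p) = at xs p

at-lookup : ∀ {n m} (w : Vec (Fin n) m) i → at w (toℕ i) ≡ toℕ (lookup w i)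
at-lookup (x ∷ w) F.zero    = refl
at-lookup (x ∷ w) (F.suc i) = at-lookup w i

at-fromℕ< : ∀ {n m} (w : Vec (Fin n) m) {p} (p<m : p < m) → at w p ≡ toℕ (lookup w (fromℕ< p<m))
at-fromℕ< w p<m = trans (cong (at w) (sym (toℕ-fromℕ< p<m))) (at-lookup w (fromℕ< p<m))

at-< : ∀ {n m} (w : Vec (Fin n) m) {p} → p < m → at w p < n
at-< (x ∷ w) {zero}  _     = toℕ<n x
at-< (x ∷ w) {suc p} 1+p<m = at-< w (≤-pred 1+p<m)

IsPerm⇒InjectiveBelow : ∀ {n} (w : Vec (Fin n) n) → IsPerm w → InjectiveBelow n (at w)
IsPerm⇒InjectiveBelow w perm {p} {q} p<n q<n wp≡wq = begin
  p                 ≡⟨ toℕ-fromℕ< p<n ⟨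
  toℕ (fromℕ< p<n)  ≡⟨ cong toℕ (perm _ _ (toℕ-injective lookups≡)) ⟩
  toℕ (fromℕ< q<n)  ≡⟨ toℕ-fromℕ< q<n ⟩
  q                 ∎
  where
  open ≡-Reasoning
  lookups≡ : toℕ (lookup w (fromℕ< p<n)) ≡ toℕ (lookup w (fromℕ< q<n))
  lookups≡ = trans (sym (at-fromℕ< w p<n)) (trans wp≡wq (at-fromℕ< w q<n))

InjectiveBelow⇒IsPerm : ∀ {n} (w : Vec (Fin n) n) → InjectiveBelow n (at w) → IsPerm w
InjectiveBelow⇒IsPerm w inj i j wi≡wj =
  toℕ-injective (inj (toℕ<n i) (toℕ<n j) (trans (at-lookup w i) (trans (cong toℕ wi≡wj) (sym (at-lookup w j)))))

isPerm? : ∀ {k} (σ : Vec (Fin k) k) → Dec (IsPerm σ)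
isPerm? σ = Finₚ.all? λ i → Finₚ.all? λ j → (lookup σ i Finₚ.≟ lookup σ j) →-dec (i Finₚ.≟ j)

restrict : ∀ {k n} (pos : ℕ → ℕ) → (∀ {i} → i < k → pos i < n) → Fin k → Fin n
restrict pos pos<n i = fromℕ< (pos<n (toℕ<n i))

occurrence-at : ∀ {k n} (σ : Vec (Fin k) k) → IsPerm σ → (w : Vec (Fin n) n)
                (pos : ℕ → ℕ) (pos<n : ∀ {i} → i < k → pos i < n) →
                (∀ {i j} → i < j → j < k → pos i < pos j) →
                (∀ a b → lookup σ a <ᶠ lookup σ b → at w (pos (toℕ a)) < at w (pos (toℕ b))) →
                IsOccurrence σ w (restrict pos pos<n)
occurrence-at σ σ-perm w pos pos<n increasing order =
  (λ a b a<b → subst₂ _<_ (sym (toℕ-f a)) (sym (toℕ-f b)) (increasing a<b (toℕ<n b))) ,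
  (λ a b → mk⇔ (reflect a b) (preserve a b))
  where
  f : Fin _ → Fin _
  f = restrict pos pos<n
  toℕ-f : ∀ i → toℕ (f i) ≡ pos (toℕ i)
  toℕ-f i = toℕ-fromℕ< (pos<n (toℕ<n i))
  value-f : ∀ i → toℕ (lookup w (f i)) ≡ at w (pos (toℕ i))
  value-f i = trans (sym (at-lookup w (f i))) (cong (at w) (toℕ-f i))
  preserve : ∀ a b → lookup σ a <ᶠ lookup σ b → lookup w (f a) <ᶠ lookup w (f b)
  preserve a b σa<σb = subst₂ _<_ (sym (value-f a)) (sym (value-f b)) (order a b σa<σb)
  reflect : ∀ a b → lookup w (f a) <ᶠ lookup w (f b) → lookup σ a <ᶠ lookup σ b
  reflect a b wfa<wfb with <-cmp (toℕ (lookup σ a)) (toℕ (lookup σ b))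
  ... | tri< σa<σb _ _ = σa<σb
  ... | tri≈ _ σa≡σb _ =
    ⊥-elim (<-irrefl (cong (λ i → toℕ (lookup w (f i))) (σ-perm a b (toℕ-injective σa≡σb))) wfa<wfb)
  ... | tri> _ _ σb<σa = ⊥-elim (<-asym wfa<wfb (preserve b a σb<σa))

occurrence-values : ∀ {k n} (σ : Vec (Fin k) k) (w : Vec (Fin n) n) {f} → IsOccurrence σ w f →
                    ∀ a b → lookup σ a <ᶠ lookup σ b → at w (toℕ (f a)) < at w (toℕ (f b))
occurrence-values σ w {f} (_ , order) a b σa<σb =
  subst₂ _<_ (sym (at-lookup w (f a))) (sym (at-lookup w (f b))) (Equivalence.from (order a b) σa<σb)

p132-perm : IsPerm p132
p132-perm = toWitness {a? = isPerm? p132} tt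

p3241-perm : IsPerm p3241
p3241-perm = toWitness {a? = isPerm? p3241} tt

module _ {n} (w : Vec (Fin n) n) where

  Avoids132⇒No132 : Avoids p132 w → No132 n (at w)
  Avoids132⇒No132 avoid {a} {b} {c} a<b b<c c<n Va<Vc Vc<Vb =
    avoid (_ , occurrence-at p132 p132-perm w pos pos<n (increasing-by-steps step) order)
    where
    pos : ℕ → ℕ
    pos 0 = a
    pos 1 = b
    pos _ = c
    pos<n : ∀ {i} → i < 3 → pos i < n
    pos<n {0}           _ = <-trans a<b (<-trans b<c c<n)
    pos<n {1}           _ = <-trans b<c c<n
    pos<n {suc (suc i)} _ = c<n
    step : ∀ {i} → suc i < 3 → pos i < pos (suc i)
    step {0}           _ = a<b
    step {1}           _ = b<c
    step {suc (suc _)} (s≤s (s≤s (s≤s ())))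
    order : ∀ i j → lookup p132 i <ᶠ lookup p132 j → at w (pos (toℕ i)) < at w (pos (toℕ j))
    order 0F 1F _ = <-trans Va<Vc Vc<Vb
    order 0F 2F _ = Va<Vc
    order 2F 1F _ = Vc<Vb
    order 0F 0F ()
    order 1F 0F ()
    order 1F 1F (s≤s (s≤s ()))
    order 1F 2F (s≤s ())
    order 2F 0F ()
    order 2F 2F (s≤s ())

  Avoids3241⇒No3241 : Avoids p3241 w → No3241 n (at w)
  Avoids3241⇒No3241 avoid {a} {b} {c} {z} a<b b<c c<z z<n Vb<Va Va<Vc Vz<Vb =
    avoid (_ , occurrence-at p3241 p3241-perm w pos pos<n (increasing-by-steps step) order)
    where
    pos : ℕ → ℕ
    pos 0 = a
    pos 1 = b
    pos 2 = c
    pos _ = z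
    pos<n : ∀ {i} → i < 4 → pos i < n
    pos<n {0}                 _ = <-trans a<b (<-trans b<c (<-trans c<z z<n))
    pos<n {1}                 _ = <-trans b<c (<-trans c<z z<n)
    pos<n {2}                 _ = <-trans c<z z<n
    pos<n {suc (suc (suc i))} _ = z<n
    step : ∀ {i} → suc i < 4 → pos i < pos (suc i)
    step {0}                 _ = a<b
    step {1}                 _ = b<c
    step {2}                 _ = c<z
    step {suc (suc (suc _))} (s≤s (s≤s (s≤s (s≤s ()))))
    order : ∀ i j → lookup p3241 i <ᶠ lookup p3241 j → at w (pos (toℕ i)) < at w (pos (toℕ j))
    order 0F 2F _ = Va<Vc
    order 1F 0F _ = Vb<Va
    order 1F 2F _ = <-trans Vb<Va Va<Vc
    order 3F 0F _ = <-trans Vz<Vb Vb<Va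
    order 3F 1F _ = Vz<Vb
    order 3F 2F _ = <-trans Vz<Vb (<-trans Vb<Va Va<Vc)
    order 0F 0F (s≤s (s≤s ()))
    order 0F 1F (s≤s ())
    order 0F 3F ()
    order 1F 1F (s≤s ())
    order 1F 3F ()
    order 2F 0F (s≤s (s≤s ()))
    order 2F 1F (s≤s ())
    order 2F 2F (s≤s (s≤s (s≤s ())))
    order 2F 3F ()
    order 3F 3F ()

  No132⇒Avoids132 : No132 n (at w) → Avoids p132 w
  No132⇒Avoids132 no132 (f , occ@(increasing , _)) =
    no132 (increasing 0F 1F z<s) (increasing 1F 2F (s<s z<s)) (toℕ<n (f 2F))
          (occurrence-values p132 w occ 0F 2F z<s) (occurrence-values p132 w occ 2F 1F (s<s z<s))

  No2341⇒Avoids2341 : No2341 n (at w) → Avoids p2341 w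
  No2341⇒Avoids2341 no2341 (f , occ@(increasing , _)) =
    no2341 (increasing 0F 1F z<s) (increasing 1F 2F (s<s z<s)) (increasing 2F 3F (s<s (s<s z<s)))
           (toℕ<n (f 3F)) (occurrence-values p2341 w occ 3F 0F z<s)
           (occurrence-values p2341 w occ 0F 1F (s<s z<s)) (occurrence-values p2341 w occ 1F 2F (s<s (s<s z<s)))

  No3241⇒Avoids3241 : No3241 n (at w) → Avoids p3241 w
  No3241⇒Avoids3241 no3241 (f , occ@(increasing , _)) =
    no3241 (increasing 0F 1F z<s) (increasing 1F 2F (s<s z<s)) (increasing 2F 3F (s<s (s<s z<s)))
           (toℕ<n (f 3F)) (occurrence-values p3241 w occ 1F 0F (s<s z<s))
           (occurrence-values p3241 w occ 0F 2F (s<s (s<s z<s))) (occurrence-values p3241 w occ 3F 1F z<s)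

module _ {d : ℕ} where
  private
    τ : Vec (Fin d) d
    τ = decreasing d

  toℕ-decreasing : ∀ a → toℕ (lookup τ a) ≡ d ∸ suc (toℕ a)
  toℕ-decreasing a = trans (cong toℕ (lookup∘tabulate F.opposite a)) (Finₚ.opposite-prop a)

  decreasing-order : ∀ a b → lookup τ a <ᶠ lookup τ b → toℕ b < toℕ a
  decreasing-order a b τa<τb =
    ≤-pred (∸-cancelʳ-< {o = d} (subst₂ _<_ (toℕ-decreasing a) (toℕ-decreasing b) τa<τb))

  decreasing-order⁻ : ∀ a b → toℕ b < toℕ a → lookup τ a <ᶠ lookup τ b
  decreasing-order⁻ a b b<a =
    subst₂ _<_ (sym (toℕ-decreasing a)) (sym (toℕ-decreasing b)) (∸-monoʳ-< (s≤s b<a) (toℕ<n a))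

  decreasing-perm : IsPerm τ
  decreasing-perm a b τa≡τb = begin
    a                            ≡⟨ Finₚ.opposite-involutive a ⟨
    F.opposite (F.opposite a)    ≡⟨ cong F.opposite opposites≡ ⟩
    F.opposite (F.opposite b)    ≡⟨ Finₚ.opposite-involutive b ⟩
    b                            ∎
    where
    open ≡-Reasoning
    opposites≡ : F.opposite a ≡ F.opposite b
    opposites≡ = trans (sym (lookup∘tabulate F.opposite a)) (trans τa≡τb (lookup∘tabulate F.opposite b))

  module _ {n} (w : Vec (Fin n) n) where

    positions-of : (Fin d → Fin n) → ℕ → ℕ
    positions-of f = at (tabulate f)

    positions-of-toℕ : ∀ f i → positions-of f (toℕ i) ≡ toℕ (f i)
    positions-of-toℕ f i = trans (at-lookup (tabulate f) i) (cong toℕ (lookup∘tabulate f i))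

    occurrence⇒DecreasingOcc : ∀ {f} → IsOccurrence τ w f → DecreasingOcc d n (at w) (positions-of f)
    occurrence⇒DecreasingOcc {f} occ@(increasing , _) = record
      { positions-increase = λ j<k k<d →
          subst₂ _<_ (sym (P≡ (<-trans j<k k<d))) (sym (P≡ k<d)) (increasing _ _ (slot-< j<k k<d))
      ; values-decrease    = λ j<k k<d →
          subst₂ (λ p q → at w p < at w q) (sym (P≡ k<d)) (sym (P≡ (<-trans j<k k<d)))
                 (occurrence-values τ w occ _ _ (decreasing-order⁻ _ _ (slot-< j<k k<d)))
      ; in-range           = λ j<d → subst (_< n) (sym (P≡ j<d)) (toℕ<n _)
      }
      where
      P≡ : ∀ {j} (j<d : j < d) → positions-of f j ≡ toℕ (f (fromℕ< j<d))
      P≡ j<d = trans (cong (positions-of f) (sym (toℕ-fromℕ< j<d))) (positions-of-toℕ f _)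
      slot-< : ∀ {j k} (j<k : j < k) (k<d : k < d) → fromℕ< (<-trans j<k k<d) <ᶠ fromℕ< k<d
      slot-< j<k k<d = subst₂ _<_ (sym (toℕ-fromℕ< (<-trans j<k k<d))) (sym (toℕ-fromℕ< k<d)) j<k

    DecreasingOcc⇒occurrence : ∀ {P} (occ : DecreasingOcc d n (at w) P) →
                               IsOccurrence τ w (restrict P (DecreasingOcc.in-range occ))
    DecreasingOcc⇒occurrence {P} occ = occurrence-at τ decreasing-perm w P in-range positions-increase
      (λ a b τa<τb → values-decrease (decreasing-order a b τa<τb) (toℕ<n a))
      where open DecreasingOcc occ

    ExactlyOne⇒UniqueDecreasingOcc : ExactlyOne τ w →
      Σ (ℕ → ℕ) λ P → DecreasingOcc d n (at w) P × UniqueDecreasingOcc d n (at w) P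
    ExactlyOne⇒UniqueDecreasingOcc ((f , occ) , unique) = positions-of f , occurrence⇒DecreasingOcc occ , only
      where
      only : UniqueDecreasingOcc d n (at w) (positions-of f)
      only Q occQ {j} j<d = begin
        Q j                                  ≡⟨ cong Q (toℕ-fromℕ< j<d) ⟨
        Q (toℕ (fromℕ< j<d))                 ≡⟨ toℕ-fromℕ< _ ⟨
        toℕ (restrict Q Q<n (fromℕ< j<d))    ≡⟨ cong toℕ (unique _ f (DecreasingOcc⇒occurrence occQ) occ _) ⟩
        toℕ (f (fromℕ< j<d))                 ≡⟨ positions-of-toℕ f _ ⟨
        positions-of f (toℕ (fromℕ< j<d))    ≡⟨ cong (positions-of f) (toℕ-fromℕ< j<d) ⟩
        positions-of f j                     ∎
        where
        open ≡-Reasoning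
        Q<n : ∀ {i} → i < d → Q i < n
        Q<n = DecreasingOcc.in-range occQ

    UniqueDecreasingOcc⇒ExactlyOne : DecreasingOcc d n (at w) (λ j → j) →
                                     UniqueDecreasingOcc d n (at w) (λ j → j) → ExactlyOne τ w
    UniqueDecreasingOcc⇒ExactlyOne occ unique =
      (_ , DecreasingOcc⇒occurrence occ) ,
      λ f g occf occg i → toℕ-injective (trans (slot occf i) (sym (slot occg i)))
      where
      slot : ∀ {f} → IsOccurrence τ w f → ∀ i → toℕ (f i) ≡ toℕ i
      slot {f} occf i = trans (sym (positions-of-toℕ f i)) (unique _ (occurrence⇒DecreasingOcc occf) (toℕ<n i))

IsValleyPerm : ℕ → ∀ n → Vec (Fin n) n → Set
IsValleyPerm e n w = InjectiveBelow n (at w) × IsValley e n (at w)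

module _ (e : ℕ) {n} (w : Vec (Fin n) n) where

  counted⇒IsValleyPerm : InP132 w × ExactlyOne (decreasing (2 + e)) w → IsValleyPerm e n w
  counted⇒IsValleyPerm ((perm , avoid132 , _ , avoid3241) , exactlyOne) =
    let (_ , occ , unique) = ExactlyOne⇒UniqueDecreasingOcc w exactlyOne
    in inj , UniqueOccurrenceIsValley.isValley inj (Avoids132⇒No132 w avoid132) (Avoids3241⇒No3241 w avoid3241)
                                                occ unique
    where
    inj : InjectiveBelow n (at w)
    inj = IsPerm⇒InjectiveBelow w perm

  IsValleyPerm⇒counted : IsValleyPerm e n w → InP132 w × ExactlyOne (decreasing (2 + e)) w
  IsValleyPerm⇒counted (inj , valley) =
    ( InjectiveBelow⇒IsPerm w inj
    , No132⇒Avoids132 w (valley-no132 valley)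
    , No2341⇒Avoids2341 w (valley-no2341 valley)
    , No3241⇒Avoids3241 w (valley-no3241 valley)) ,
    UniqueDecreasingOcc⇒ExactlyOne w (valley-occurrence valley) (valley-unique valley)

-- Counting valleys by the position of the largest entry

consMax : ∀ {n} → Vec (Fin n) n → Vec (Fin (suc n)) (suc n)
consMax {n} w = fromℕ n ∷ map inject₁ w

snocMax : ∀ {n} → Vec (Fin n) n → Vec (Fin (suc n)) (suc n)
snocMax {n} w = map inject₁ w ∷ʳ fromℕ n

at-map-inject₁ : ∀ {n m} (w : Vec (Fin n) m) p → at (map inject₁ w) p ≡ at w p
at-map-inject₁ []      p       = refl
at-map-inject₁ (x ∷ w) zero    = toℕ-inject₁ x
at-map-inject₁ (x ∷ w) (suc p) = at-map-inject₁ w p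

at-∷ʳ-< : ∀ {n m} (ys : Vec (Fin n) m) y {p} → p < m → at (ys ∷ʳ y) p ≡ at ys p
at-∷ʳ-< (x ∷ ys) y {zero}  _     = refl
at-∷ʳ-< (x ∷ ys) y {suc p} 1+p<m = at-∷ʳ-< ys y (≤-pred 1+p<m)

at-∷ʳ-last : ∀ {n m} (ys : Vec (Fin n) m) y → at (ys ∷ʳ y) m ≡ toℕ y
at-∷ʳ-last []       y = refl
at-∷ʳ-last (x ∷ ys) y = at-∷ʳ-last ys y

module _ {n} (w : Vec (Fin n) n) where
  private
    V V⁺ V₊ : ℕ → ℕ
    V  = at w
    V⁺ = at (snocMax w)
    V₊ = at (consMax w)

  at-snocMax-< : ∀ {p} → p < n → V⁺ p ≡ V p
  at-snocMax-< p<n = trans (at-∷ʳ-< (map inject₁ w) (fromℕ n) p<n) (at-map-inject₁ w _)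

  at-snocMax-last : V⁺ n ≡ n
  at-snocMax-last = trans (at-∷ʳ-last (map inject₁ w) (fromℕ n)) (toℕ-fromℕ n)

  at-consMax-suc : ∀ p → V₊ (suc p) ≡ V p
  at-consMax-suc = at-map-inject₁ w

  at-consMax-zero : V₊ 0 ≡ n
  at-consMax-zero = toℕ-fromℕ n

  private
    snoc-< : ∀ {p q} → p < n → q < n → V p < V q → V⁺ p < V⁺ q
    snoc-< p<n q<n = subst₂ _<_ (sym (at-snocMax-< p<n)) (sym (at-snocMax-< q<n))

    snoc-<-last : ∀ {p} → p < n → V⁺ p < V⁺ n
    snoc-<-last p<n = subst₂ _<_ (sym (at-snocMax-< p<n)) (sym at-snocMax-last) (at-< w p<n)

    unsnoc-< : ∀ {p q} → p < n → q < n → V⁺ p < V⁺ q → V p < V q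
    unsnoc-< p<n q<n = subst₂ _<_ (at-snocMax-< p<n) (at-snocMax-< q<n)

    cons-< : ∀ {p q} → V p < V q → V₊ (suc p) < V₊ (suc q)
    cons-< = subst₂ _<_ (sym (at-consMax-suc _)) (sym (at-consMax-suc _))

    cons-<-first : ∀ {p} → p < n → V₊ (suc p) < V₊ 0
    cons-<-first p<n = subst₂ _<_ (sym (at-consMax-suc _)) (sym at-consMax-zero) (at-< w p<n)

    uncons-< : ∀ {p q} → V₊ (suc p) < V₊ (suc q) → V p < V q
    uncons-< = subst₂ _<_ (at-consMax-suc _) (at-consMax-suc _)

  valley-snocMax : ∀ {e} → IsValley e n V → IsValley e (suc n) V⁺
  valley-snocMax {e} valley = record
    { long-enough = m≤n⇒m≤1+n long-enough
    ; descent     = λ i<j j≤1+e → snoc-< (≤1+e⇒<n j≤1+e) (<-trans i<j (≤1+e⇒<n j≤1+e)) (descent i<j j≤1+e)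
    ; ascent      = ascent⁺
    ; tail-above  = tail-above⁺
    }
    where
    open IsValley valley
    ≤1+e⇒<n : ∀ {j} → j ≤ suc e → j < n
    ≤1+e⇒<n j≤1+e = <-≤-trans (s≤s j≤1+e) long-enough
    ascent⁺ : ∀ {i j} → suc e ≤ i → i < j → j < suc n → V⁺ i < V⁺ j
    ascent⁺ 1+e≤i i<j j<1+n with m<1+n⇒m<n∨m≡n j<1+n
    ... | inj₁ j<n  = snoc-< (<-trans i<j j<n) j<n (ascent 1+e≤i i<j j<n)
    ... | inj₂ refl = snoc-<-last i<j
    tail-above⁺ : ∀ {j} → 2 + e ≤ j → j < suc n → V⁺ e < V⁺ j
    tail-above⁺ 2+e≤j j<1+n with m<1+n⇒m<n∨m≡n j<1+n
    ... | inj₁ j<n  = snoc-< (≤1+e⇒<n (n≤1+n e)) j<n (tail-above 2+e≤j j<n)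
    ... | inj₂ refl = snoc-<-last (≤1+e⇒<n (n≤1+n e))

  valley-snocMax⁻ : ∀ {e} → 2 + e ≤ n → IsValley e (suc n) V⁺ → IsValley e n V
  valley-snocMax⁻ {e} 2+e≤n valley = record
    { long-enough = 2+e≤n
    ; descent     = λ i<j j≤1+e → unsnoc-< (≤1+e⇒<n j≤1+e) (<-trans i<j (≤1+e⇒<n j≤1+e)) (descent i<j j≤1+e)
    ; ascent      = λ 1+e≤i i<j j<n → unsnoc-< (<-trans i<j j<n) j<n (ascent 1+e≤i i<j (m<n⇒m<1+n j<n))
    ; tail-above  = λ 2+e≤j j<n → unsnoc-< (≤1+e⇒<n (n≤1+n e)) j<n (tail-above 2+e≤j (m<n⇒m<1+n j<n))
    }
    where
    open IsValley valley
    ≤1+e⇒<n : ∀ {j} → j ≤ suc e → j < n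
    ≤1+e⇒<n j≤1+e = <-≤-trans (s≤s j≤1+e) 2+e≤n

  valley-consMax : ∀ {e} → IsValley e n V → IsValley (suc e) (suc n) V₊
  valley-consMax {e} valley = record
    { long-enough = s≤s long-enough
    ; descent     = descent₊
    ; ascent      = λ { {suc i} {suc j} (s≤s 1+e≤i) (s≤s i<j) (s≤s j<n) → cons-< (ascent 1+e≤i i<j j<n) }
    ; tail-above  = λ { {suc j} (s≤s 2+e≤j) (s≤s j<n) → cons-< (tail-above 2+e≤j j<n) }
    }
    where
    open IsValley valley
    descent₊ : ∀ {i j} → i < j → j ≤ suc (suc e) → V₊ j < V₊ i
    descent₊ {zero}  {suc j} _         (s≤s j≤1+e) = cons-<-first (<-≤-trans (s≤s j≤1+e) long-enough)
    descent₊ {suc i} {suc j} (s≤s i<j) (s≤s j≤1+e) = cons-< (descent i<j j≤1+e)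

  valley-consMax⁻ : ∀ {e} → IsValley (suc e) (suc n) V₊ → IsValley e n V
  valley-consMax⁻ valley = record
    { long-enough = ≤-pred long-enough
    ; descent     = λ i<j j≤1+e → uncons-< (descent (s≤s i<j) (s≤s j≤1+e))
    ; ascent      = λ 1+e≤i i<j j<n → uncons-< (ascent (s≤s 1+e≤i) (s≤s i<j) (s≤s j<n))
    ; tail-above  = λ 2+e≤j j<n → uncons-< (tail-above (s≤s 2+e≤j) (s≤s j<n))
    }
    where open IsValley valley

  injectiveBelow-snocMax : InjectiveBelow n V → InjectiveBelow (suc n) V⁺
  injectiveBelow-snocMax inj p<1+n q<1+n V⁺p≡V⁺q with m<1+n⇒m<n∨m≡n p<1+n | m<1+n⇒m<n∨m≡n q<1+n
  ... | inj₁ p<n  | inj₁ q<n  = inj p<n q<n (trans (sym (at-snocMax-< p<n)) (trans V⁺p≡V⁺q (at-snocMax-< q<n)))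
  ... | inj₁ p<n  | inj₂ refl = ⊥-elim (<⇒≢ (snoc-<-last p<n) V⁺p≡V⁺q)
  ... | inj₂ refl | inj₁ q<n  = ⊥-elim (<⇒≢ (snoc-<-last q<n) (sym V⁺p≡V⁺q))
  ... | inj₂ refl | inj₂ refl = refl

  injectiveBelow-snocMax⁻ : InjectiveBelow (suc n) V⁺ → InjectiveBelow n V
  injectiveBelow-snocMax⁻ inj p<n q<n Vp≡Vq =
    inj (m<n⇒m<1+n p<n) (m<n⇒m<1+n q<n) (trans (at-snocMax-< p<n) (trans Vp≡Vq (sym (at-snocMax-< q<n))))

  injectiveBelow-consMax : InjectiveBelow n V → InjectiveBelow (suc n) V₊
  injectiveBelow-consMax inj {zero}  {zero}  _         _         _       = refl
  injectiveBelow-consMax inj {zero}  {suc q} _         (s≤s q<n) V₊0≡V₊q =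
    ⊥-elim (<⇒≢ (cons-<-first q<n) (sym V₊0≡V₊q))
  injectiveBelow-consMax inj {suc p} {zero}  (s≤s p<n) _         V₊p≡V₊0 =
    ⊥-elim (<⇒≢ (cons-<-first p<n) V₊p≡V₊0)
  injectiveBelow-consMax inj {suc p} {suc q} (s≤s p<n) (s≤s q<n) V₊p≡V₊q =
    cong suc (inj p<n q<n (trans (sym (at-consMax-suc p)) (trans V₊p≡V₊q (at-consMax-suc q))))

  injectiveBelow-consMax⁻ : InjectiveBelow (suc n) V₊ → InjectiveBelow n V
  injectiveBelow-consMax⁻ inj p<n q<n Vp≡Vq =
    suc-injective (inj (s≤s p<n) (s≤s q<n) (trans (at-consMax-suc _) (trans Vp≡Vq (sym (at-consMax-suc _)))))

  IsValleyPerm-snocMax : ∀ {e} → IsValleyPerm e n w → IsValleyPerm e (suc n) (snocMax w)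
  IsValleyPerm-snocMax (inj , valley) = injectiveBelow-snocMax inj , valley-snocMax valley

  IsValleyPerm-snocMax⁻ : ∀ {e} → 2 + e ≤ n → IsValleyPerm e (suc n) (snocMax w) → IsValleyPerm e n w
  IsValleyPerm-snocMax⁻ 2+e≤n (inj , valley) = injectiveBelow-snocMax⁻ inj , valley-snocMax⁻ 2+e≤n valley

  IsValleyPerm-consMax : ∀ {e} → IsValleyPerm e n w → IsValleyPerm (suc e) (suc n) (consMax w)
  IsValleyPerm-consMax (inj , valley) = injectiveBelow-consMax inj , valley-consMax valley

  IsValleyPerm-consMax⁻ : ∀ {e} → IsValleyPerm (suc e) (suc n) (consMax w) → IsValleyPerm e n w
  IsValleyPerm-consMax⁻ (inj , valley) = injectiveBelow-consMax⁻ inj , valley-consMax⁻ valley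

map-inject₁-injective : ∀ {n m} {a b : Vec (Fin n) m} → map inject₁ a ≡ map inject₁ b → a ≡ b
map-inject₁-injective {a = []}    {[]}    _  = refl
map-inject₁-injective {a = x ∷ a} {y ∷ b} eq =
  cong₂ _∷_ (Finₚ.inject₁-injective (∷-injectiveˡ eq)) (map-inject₁-injective (∷-injectiveʳ eq))

snocMax-injective : ∀ {n} {a b : Vec (Fin n) n} → snocMax a ≡ snocMax b → a ≡ b
snocMax-injective {a = a} {b} eq = map-inject₁-injective (∷ʳ-injectiveˡ (map inject₁ a) (map inject₁ b) eq)

consMax-injective : ∀ {n} {a b : Vec (Fin n) n} → consMax a ≡ consMax b → a ≡ b
consMax-injective eq = map-inject₁-injective (∷-injectiveʳ eq)

map-inject₁-preimage : ∀ {n m} (ys : Vec (Fin (suc n)) m) → (∀ {p} → p < m → at ys p < n) →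
                       Σ (Vec (Fin n) m) λ xs → map inject₁ xs ≡ ys
map-inject₁-preimage []       _     = [] , refl
map-inject₁-preimage (y ∷ ys) below =
  let (xs , xs↦ys) = map-inject₁-preimage ys (λ p<m → below (s≤s p<m))
  in F.lower₁ y n≢y ∷ xs , cong₂ _∷_ (Finₚ.inject₁-lower₁ y n≢y) xs↦ys
  where
  n≢y : _ ≢ toℕ y
  n≢y = >⇒≢ (below z<s)

module _ {N} (w : Vec (Fin (suc N)) (suc N)) (inj : InjectiveBelow (suc N) (at w)) where

  largest-entry : Σ ℕ λ p → p < suc N × at w p ≡ N
  largest-entry =
    let (j , _ , N≤wj) = Finₚ.injective⇒existsPivot (λ {i} {j} → InjectiveBelow⇒IsPerm w inj i j) (fromℕ N)
    in toℕ j , toℕ<n j ,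
       trans (at-lookup w j)
             (≤-antisym (≤-pred (toℕ<n (lookup w j))) (subst (_≤ toℕ (lookup w j)) (toℕ-fromℕ N) N≤wj))

  below-largest : ∀ {p₀} → p₀ < suc N → at w p₀ ≡ N → ∀ {p} → p < suc N → p ≢ p₀ → at w p < N
  below-largest p₀<1+N wp₀≡N p<1+N p≢p₀ =
    ≤∧≢⇒< (≤-pred (at-< w p<1+N)) (λ wp≡N → p≢p₀ (inj p<1+N p₀<1+N (trans wp≡N (sym wp₀≡N))))

snocMax-preimage : ∀ {N} (w : Vec (Fin (suc N)) (suc N)) → InjectiveBelow (suc N) (at w) → at w N ≡ N →
                   Σ (Vec (Fin N) N) λ w₀ → snocMax w₀ ≡ w
snocMax-preimage {N} w inj wN≡N with initLast w
... | ys , y , refl =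
  let (w₀ , w₀↦ys) = map-inject₁-preimage ys below
  in w₀ , cong₂ _∷ʳ_ w₀↦ys (toℕ-injective (trans (toℕ-fromℕ N) (sym (trans (sym (at-∷ʳ-last ys y)) wN≡N))))
  where
  below : ∀ {p} → p < N → at ys p < N
  below p<N = subst (_< N) (at-∷ʳ-< ys y p<N)
                (below-largest (ys ∷ʳ y) inj (n<1+n N) wN≡N (m<n⇒m<1+n p<N) (<⇒≢ p<N))

consMax-preimage : ∀ {N} (w : Vec (Fin (suc N)) (suc N)) → InjectiveBelow (suc N) (at w) → at w 0 ≡ N →
                   Σ (Vec (Fin N) N) λ w₀ → consMax w₀ ≡ w
consMax-preimage {N} (y ∷ ys) inj w0≡N =
  let (w₀ , w₀↦ys) = map-inject₁-preimage ys (λ p<N → below-largest (y ∷ ys) inj z<s w0≡N (s≤s p<N) λ ())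
  in w₀ , cong₂ _∷_ (toℕ-injective (trans (toℕ-fromℕ N) (sym w0≡N))) w₀↦ys

module _ {e N V} (valley : IsValley e (suc N) V) (bounded : ∀ {q} → q < suc N → V q ≤ N) where
  open IsValley valley

  largest-at-an-end : ∀ {p} → p < suc N → V p ≡ N → p ≡ 0 ⊎ p ≡ N
  largest-at-an-end {zero}  _       _    = inj₁ refl
  largest-at-an-end {suc p} 1+p<1+N Vp≡N with m<1+n⇒m<n∨m≡n 1+p<1+N
  ... | inj₂ 1+p≡N = inj₂ 1+p≡N
  ... | inj₁ 1+p<N with ≤-total (suc p) (suc e)
  ...   | inj₁ 1+p≤1+e =
    ⊥-elim (<⇒≱ (descent z<s 1+p≤1+e) (subst (V 0 ≤_) (sym Vp≡N) (bounded z<s)))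
  ...   | inj₂ 1+e≤1+p =
    ⊥-elim (<⇒≱ (ascent 1+e≤1+p 1+p<N (n<1+n N)) (subst (V N ≤_) (sym Vp≡N) (bounded (n<1+n N))))

  largest-last⇒long-enough : 0 < N → V N ≡ N → 2 + e ≤ N
  largest-last⇒long-enough 0<N VN≡N =
    ≮⇒≥ λ N<2+e → <⇒≱ (descent 0<N (≤-pred N<2+e)) (subst (V 0 ≤_) (sym VN≡N) (bounded z<s))

data MaxView : ℕ → ∀ {N} → Vec (Fin (suc N)) (suc N) → Set where
  max-last  : ∀ {e N} {w₀ : Vec (Fin N) N} → IsValleyPerm e N w₀ → MaxView e (snocMax w₀)
  max-first : ∀ {e N} {w₀ : Vec (Fin N) N} → IsValleyPerm e N w₀ → MaxView (suc e) (consMax w₀)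

maxView-last : ∀ {e N} (w : Vec (Fin (suc N)) (suc N)) → 0 < N → IsValleyPerm e (suc N) w →
               at w N ≡ N → MaxView e w
maxView-last {e} {N} w 0<N vp@(inj , valley) wN≡N =
  let (w₀ , w₀↦w) = snocMax-preimage w inj wN≡N
      2+e≤N = largest-last⇒long-enough valley (λ q<1+N → ≤-pred (at-< w q<1+N)) 0<N wN≡N
  in subst (MaxView e) w₀↦w
       (max-last (IsValleyPerm-snocMax⁻ w₀ 2+e≤N (subst (IsValleyPerm e (suc N)) (sym w₀↦w) vp)))

maxView-first : ∀ {e N} (w : Vec (Fin (suc N)) (suc N)) → 2 ≤ N → IsValleyPerm e (suc N) w →
                at w 0 ≡ N → MaxView e w
maxView-first {zero} w 2≤N (_ , valley) w0≡N =
  ⊥-elim (<⇒≱ (IsValley.tail-above valley ≤-refl (s≤s 2≤N))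
              (subst (at w 2 ≤_) (sym w0≡N) (≤-pred (at-< w (s≤s 2≤N)))))
maxView-first {suc e} {N} w _ vp@(inj , _) w0≡N =
  let (w₀ , w₀↦w) = consMax-preimage w inj w0≡N
  in subst (MaxView (suc e)) w₀↦w
       (max-first (IsValleyPerm-consMax⁻ w₀ (subst (IsValleyPerm (suc e) (suc N)) (sym w₀↦w) vp)))

maxView : ∀ {e N} (w : Vec (Fin (suc N)) (suc N)) → 2 ≤ N → IsValleyPerm e (suc N) w → MaxView e w
maxView {N = N} w 2≤N vp@(inj , valley) =
  let (p , p<1+N , wp≡N) = largest-entry w inj
  in [ (λ p≡0 → maxView-first w 2≤N vp (subst (λ q → at w q ≡ N) p≡0 wp≡N))
     , (λ p≡N → maxView-last w (<-≤-trans z<s 2≤N) vp (subst (λ q → at w q ≡ N) p≡N wp≡N))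
     ]′ (largest-at-an-end valley (λ q<1+N → ≤-pred (at-< w q<1+N)) p<1+N wp≡N)

valleys : (e n : ℕ) → List (Vec (Fin n) n)
valleys e       0                   = []
valleys e       1                   = []
valleys zero    2                   = (1F ∷ 0F ∷ []) ∷ []
valleys (suc e) 2                   = []
valleys zero    (suc (suc (suc m))) = L.map snocMax (valleys zero (suc (suc m)))
valleys (suc e) (suc (suc (suc m))) =
  L.map snocMax (valleys (suc e) (suc (suc m))) ++ L.map consMax (valleys e (suc (suc m)))

length-valleys : ∀ e m → length (valleys e (2 + m)) ≡ m C e
length-valleys zero    zero    = refl
length-valleys (suc e) zero    = refl
length-valleys zero    (suc m) = trans (length-map snocMax (valleys zero (2 + m))) (length-valleys zero m)
length-valleys (suc e) (suc m) = begin
  length (L.map snocMax A ++ L.map consMax B)          ≡⟨ length-++ (L.map snocMax A) ⟩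
  length (L.map snocMax A) + length (L.map consMax B)  ≡⟨ cong₂ _+_ (length-map snocMax A) (length-map consMax B) ⟩
  length A + length B                                  ≡⟨ cong₂ _+_ (length-valleys (suc e) m) (length-valleys e m) ⟩
  m C suc e + m C e                                    ≡⟨ +-comm (m C suc e) (m C e) ⟩
  m C e + m C suc e                                    ≡⟨ nCk+nC[k+1]≡[n+1]C[k+1] m e ⟩
  suc m C suc e                                        ∎
  where
  open ≡-Reasoning
  A B : List (Vec (Fin (2 + m)) (2 + m))
  A = valleys (suc e) (2 + m)
  B = valleys e (2 + m)

valleys-unique : ∀ e n → Unique (valleys e n)
valleys-unique e       0                   = []
valleys-unique e       1                   = []
valleys-unique zero    2                   = All.[] ∷ []
valleys-unique (suc e) 2                   = []
valleys-unique zero    (suc (suc (suc m))) = Unique.map⁺ snocMax-injective (valleys-unique zero (suc (suc m)))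
valleys-unique (suc e) (suc (suc (suc m))) =
  Unique.++⁺ (Unique.map⁺ snocMax-injective (valleys-unique (suc e) (suc (suc m))))
             (Unique.map⁺ consMax-injective (valleys-unique e (suc (suc m))))
             snoc≢cons
  where
  snoc≢cons : Disjoint (L.map snocMax (valleys (suc e) (2 + m))) (L.map consMax (valleys e (2 + m)))
  snoc≢cons (v∈snoc , v∈cons) with ∈-map⁻ snocMax v∈snoc | ∈-map⁻ consMax v∈cons
  ... | a , _ , refl | b , _ , a↦b =
    <⇒≢ (subst (_< 2 + m) (sym (at-snocMax-< a z<s)) (at-< a z<s))
        (trans (cong (λ v → at v 0) a↦b) (at-consMax-zero b))

IsValleyPerm-10 : IsValleyPerm 0 2 (1F ∷ 0F ∷ [])
IsValleyPerm-10 = IsPerm⇒InjectiveBelow w (toWitness {a? = isPerm? w} tt) , record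
  { long-enough = ≤-refl
  ; descent     = λ { {zero} {suc zero} _ _ → z<s
                    ; {suc _} {suc zero} (s≤s ()) _
                    ; {j = suc (suc _)} _ (s≤s ()) }
  ; ascent      = λ 1≤i i<j j<2 → ⊥-elim (<⇒≱ j<2 (<-≤-trans (s≤s 1≤i) i<j))
  ; tail-above  = λ 2≤j j<2 → ⊥-elim (<⇒≱ j<2 2≤j)
  }
  where
  w : Vec (Fin 2) 2
  w = 1F ∷ 0F ∷ []

snocMax-sound : ∀ {e n} {L : List (Vec (Fin n) n)} → (∀ {v} → v ∈ L → IsValleyPerm e n v) →
                ∀ {w} → w ∈ L.map snocMax L → IsValleyPerm e (suc n) w
snocMax-sound sound w∈ with ∈-map⁻ snocMax w∈
... | v , v∈ , refl = IsValleyPerm-snocMax v (sound v∈)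

consMax-sound : ∀ {e n} {L : List (Vec (Fin n) n)} → (∀ {v} → v ∈ L → IsValleyPerm e n v) →
                ∀ {w} → w ∈ L.map consMax L → IsValleyPerm (suc e) (suc n) w
consMax-sound sound w∈ with ∈-map⁻ consMax w∈
... | v , v∈ , refl = IsValleyPerm-consMax v (sound v∈)

valleys-sound : ∀ e n {w} → w ∈ valleys e n → IsValleyPerm e n w
valleys-sound zero    2                   (here refl) = IsValleyPerm-10
valleys-sound zero    (suc (suc (suc m)))             = snocMax-sound (valleys-sound zero (suc (suc m)))
valleys-sound (suc e) (suc (suc (suc m))) w∈          =
  [ snocMax-sound (valleys-sound (suc e) (suc (suc m))) , consMax-sound (valleys-sound e (suc (suc m))) ]′
  (∈-++⁻ (L.map snocMax (valleys (suc e) (2 + m))) w∈)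

MaxView⇒∈valleys : ∀ {e m} {w : Vec (Fin (3 + m)) (3 + m)} →
                   (∀ e′ w₀ → IsValleyPerm e′ (2 + m) w₀ → w₀ ∈ valleys e′ (2 + m)) →
                   MaxView e w → w ∈ valleys e (3 + m)
MaxView⇒∈valleys {zero}  complete (max-last  vp₀) = ∈-map⁺ snocMax (complete zero _ vp₀)
MaxView⇒∈valleys {suc e} complete (max-last  vp₀) = ∈-++⁺ˡ (∈-map⁺ snocMax (complete (suc e) _ vp₀))
MaxView⇒∈valleys {suc e} complete (max-first vp₀) = ∈-++⁺ʳ _ (∈-map⁺ consMax (complete e _ vp₀))

valleys-complete : ∀ e n (w : Vec (Fin n) n) → IsValleyPerm e n w → w ∈ valleys e n
valleys-complete e       0 _ (_ , record { long-enough = () })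
valleys-complete e       1 _ (_ , record { long-enough = s≤s () })
valleys-complete (suc e) 2 _ (_ , record { long-enough = s≤s (s≤s ()) })
valleys-complete zero    2 (1F ∷ 0F ∷ []) _            = here refl
valleys-complete zero    2 (0F ∷ _  ∷ []) (_ , valley) = ⊥-elim (n≮0 (IsValley.descent valley z<s ≤-refl))
valleys-complete zero    2 (1F ∷ 1F ∷ []) (_ , valley) = ⊥-elim (<-irrefl refl (IsValley.descent valley z<s ≤-refl))
valleys-complete e (suc (suc (suc m))) w vp =
  MaxView⇒∈valleys (λ e′ → valleys-complete e′ (suc (suc m))) (maxView w (s≤s (s≤s z≤n)) vp)

IsCardinality-unique : ∀ {n} {P : Vec (Fin n) n → Set} {a b : ℕ} →
                       IsCardinality P a → IsCardinality P b → a ≡ b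
IsCardinality-unique (L , uL , L⇔P , refl) (M , uM , M⇔P , refl) =
  ↭-length (∼bag⇒↭ (unique∧set⇒bag uL uM (λ {w} → mk⇔ (L⊆M w) (M⊆L w))))
  where
  L⊆M : ∀ w → w ∈ L → w ∈ M
  L⊆M w w∈L = Equivalence.from (M⇔P w) (Equivalence.to (L⇔P w) w∈L)
  M⊆L : ∀ w → w ∈ M → w ∈ L
  M⊆L w w∈M = Equivalence.from (L⇔P w) (Equivalence.to (M⇔P w) w∈M)

card-valleys : ∀ e n → IsCardinality {n} (λ w → InP132 w × ExactlyOne (decreasing (2 + e)) w)
                                        (length (valleys e n))
card-valleys e n =
  valleys e n , valleys-unique e n ,
  (λ w → mk⇔ (λ w∈ → IsValleyPerm⇒counted e w (valleys-sound e n w∈))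
             (λ counted → valleys-complete e n w (counted⇒IsValleyPerm e w counted))) ,
  refl

length-valleys-series : ∀ e → (λ n → + length (valleys e n)) ≗ shift (shift (binomS e))
length-valleys-series e zero          = refl
length-valleys-series e (suc zero)    = refl
length-valleys-series e (suc (suc m)) = cong +_ (length-valleys e m)

singletons : ∀ n → List (Vec (Fin n) n)
singletons 1 = (0F ∷ []) ∷ []
singletons _ = []

single-occurrence : ∀ {n} (w : Vec (Fin n) n) x → IsOccurrence (decreasing 1) w (λ _ → x)
single-occurrence w x =
  (λ { 0F 0F () }) ,
  (λ { 0F 0F → mk⇔ (λ lt → ⊥-elim (<-irrefl refl lt)) (λ lt → ⊥-elim (<-irrefl refl lt)) })

length1-avoids : ∀ {k} (σ : Vec (Fin (2 + k)) (2 + k)) (w : Vec (Fin 1) 1) → Avoids σ w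
length1-avoids σ w (f , increasing , _) = n≮0 (<-≤-trans (increasing 0F 1F z<s) (≤-pred (toℕ<n (f 1F))))

card-singletons : ∀ n → IsCardinality {n} (λ w → InP132 w × ExactlyOne (decreasing 1) w) (length (singletons n))
card-singletons 0 =
  [] , [] , (λ w → mk⇔ (λ ()) (λ { (_ , (f , _) , _) → ⊥-elim (Finₚ.¬Fin0 (f 0F)) })) , refl
card-singletons 1 = _ , All.[] ∷ [] , (λ w → mk⇔ counted from) , refl
  where
  w : Vec (Fin 1) 1
  w = 0F ∷ []
  Fin1-unique : ∀ (x y : Fin 1) → x ≡ y
  Fin1-unique 0F 0F = refl
  counted : ∀ {v} → v ∈ singletons 1 → InP132 v × ExactlyOne (decreasing 1) v
  counted (here refl) =
    ((λ { 0F 0F _ → refl }) , length1-avoids p132 w , length1-avoids p2341 w , length1-avoids p3241 w) ,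
    (_ , single-occurrence w 0F) , (λ f g _ _ i → Fin1-unique (f i) (g i))
  from : ∀ {v} → InP132 v × ExactlyOne (decreasing 1) v → v ∈ singletons 1
  from {0F ∷ []} _ = here refl
card-singletons (suc (suc n)) = [] , [] , (λ w → mk⇔ (λ ()) (two-occurrences w)) , refl
  where
  two-occurrences : ∀ w → InP132 w × ExactlyOne (decreasing 1) w → w ∈ []
  two-occurrences w (_ , _ , unique) =
    ⊥-elim (Finₚ.0≢1+n (unique _ _ (single-occurrence w 0F) (single-occurrence w 1F) 0F))

length-singletons-series : (λ n → + length (singletons n)) ≗ xPow 1
length-singletons-series zero          = refl
length-singletons-series (suc zero)    = refl
length-singletons-series (suc (suc n)) = refl

mainTheorem17 : ∀ (d : ℕ) → 1 ≤ d → ∀ (b : ℕ → ℕ) → CountsB1 (decreasing d) b →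
                  ∀ (n : ℕ) → (gf b ⊛ powS oneMinusX (d ∸ 1)) n ≡ xPow d n
mainTheorem17 0 () _ _ _
mainTheorem17 1 _ b counts n = begin
  (gf b ⊛ oneS) n          ≡⟨ ⊛-identityʳ (gf b) n ⟩
  + b n                    ≡⟨ cong +_ (IsCardinality-unique (counts n) (card-singletons n)) ⟩
  + length (singletons n)  ≡⟨ length-singletons-series n ⟩
  xPow 1 n                 ∎
  where open ≡-Reasoning
mainTheorem17 (suc (suc e)) _ b counts n = begin
  (gf b ⊛ powS oneMinusX (suc e)) n        ≡⟨ ⊛-powS-oneMinusX (suc e) (gf b) n ⟩
  Δ^ (suc e) (gf b) n                      ≡⟨ Δ^-cong (suc e) b≗valleys n ⟩
  Δ^ (suc e) (shift (shift (binomS e))) n  ≡⟨ Δ^-shift²-binomS e n ⟩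
  xPow (2 + e) n                           ∎
  where
  open ≡-Reasoning
  b≗valleys : gf b ≗ shift (shift (binomS e))
  b≗valleys m = trans (cong +_ (IsCardinality-unique (counts m) (card-valleys e m))) (length-valleys-series e m)
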